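{- Let $p>5$ be a prime, $k=2$, and let $e\ge1$ and $l>0$ be integers. Assume that $-\frac14$ is a quadratic non-residue of $p$. Then $D_{p^l+3,2}(1,x)$ is a permutation polynomial of $\mathbb{F}_{p^e}$ if and only if $3x^{\frac{p^l+1}{2}}+x^{\frac{p^l-1}{2}}+x$ is a permutation polynomial of $\mathbb{F}_{p^e}$.
   Context: Let $p$ be an odd prime and $k$ an integer with $0\le k\le p-1$. For $n\ge 1$, $D_{n,k}(1,x)=\sum_{i=0}^{\lfloor n/2\rfloor}\frac{n-ki}{n-i}\binom{n-i}{i}(-x)^i$, where the coefficient is the integer $\binom{n-i}{i}-(k-1)\binom{n-i-1}{i-1}$ (with $\binom{m}{ -1}=0$) viewed in $\mathbb{F}_p$; $D_{0,k}(1,x)=2-k$. Equivalently $D_{1,k}=1$ and $D_{n,k}=D_{n-1,k}-xD_{n-2,k}$ for $n\ge2$. A polynomial over $\mathbb{F}_q$ is a permutation polynomial of $\mathbb{F}_q$ if it induces a bijection of $\mathbb{F}_q$. An element $c\in\mathbb{F}_p^*$ is a quadratic residue of $p$ if $c=\beta^2$ for some $\beta\in\mathbb{F}_p^*$, otherwise a quadratic non-residue. -}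

module Defs where

open import Level using (0ℓ)
open import Data.Nat as ℕ using (ℕ; zero; suc; _%_)
open import Data.Nat.Divisibility using (_∣_)
open import Data.Fin using (Fin)
import Data.Integer as ℤ
open ℤ using (ℤ)
open import Data.Integer.Divisibility renaming (_∣_ to _ℤ∣_)
open import Data.Product using (Σ; _×_; ∃)
open import Relation.Nullary using (¬_)
open import Relation.Binary.PropositionalEquality using (_≡_)
import Relation.Binary.PropositionalEquality as P
open import Algebra.Bundles using (CommutativeRing)
open import Function.Bundles using (Inverse)
open import Function.Definitions using (Injective; Surjective)

IsQuadraticResidue : (p c : ℕ) → Set
IsQuadraticResidue p c =
  ¬ (p ∣ c) × ∃ λ (β : ℤ) → (ℤ.+ p) ℤ∣ ((β ℤ.* β) ℤ.- (ℤ.+ c))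

record FiniteField (n : ℕ) : Set₁ where
  field
    cring : CommutativeRing 0ℓ 0ℓ
  open CommutativeRing cring public
  field
    0≉1     : ¬ (0# ≈ 1#)
    inverse : ∀ x → ¬ (x ≈ 0#) → ∃ λ y → (x * y) ≈ 1#
    card    : Inverse setoid (P.setoid (Fin n))

module _ {n : ℕ} (F : FiniteField n) where
  open FiniteField F

  pow : Carrier → ℕ → Carrier
  pow x zero    = 1#
  pow x (suc m) = x * pow x m

  fromℕ : ℕ → Carrier
  fromℕ zero    = 0#
  fromℕ (suc m) = 1# + fromℕ m

  -- Dickson polynomial of the (k+1)-th kind D_{m,k}(1,x), evaluated at x:
  -- D_0 = 2 - k, D_1 = 1, D_m = D_{m-1} - x D_{m-2}.
  D : ℕ → ℕ → Carrier → Carrier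
  D zero          k x = fromℕ 2 - fromℕ k
  D (suc zero)    k x = 1#
  D (suc (suc m)) k x = D (suc m) k x - x * D m k x

  -- a function F → F induced by a polynomial is a permutation polynomial
  -- iff it is a bijection of F
  IsPermutation : (Carrier → Carrier) → Set
  IsPermutation f = Injective _≈_ _≈_ f × Surjective _≈_ _≈_ f

module Submission where

-- For a prime p > 5 with -1/4 a non-residue, D(p^l + 3, 2)(1, x) permutes
-- F_(p^e) iff 3x^((p^l+1)/2) + x^((p^l-1)/2) + x does: in fact neither is a
-- permutation, so both sides of the equivalence are false.
--
-- Let q = p ^ l = 2m + 1.  In R[θ], θ² = θ - x, one has
-- θ^(n+1) = -x D(n) + D(n+1) θ, and s = 2θ - 1 has s² = 1 - 4x; comparing
-- the Frobenius image 2θ^q - 1 of s with s^q = (1 - 4x)^m s gives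
-- 2 D(q+3) = (1 - x) + (1 - 4x)^m (1 - 3x).  Both polynomials thus depend
-- on the point through χ(a) = a^m, which is 0, 1, (-1)^m at 0, c², -c²
-- (c in the prime field), and for each parity of m we exhibit two distinct
-- points with equal values.  One pair needs p ≠ 13, which the hypothesis
-- gives since -1/4 ≡ 4² (mod 13).

open import Level using (0ℓ)
open import Algebra.Bundles using (CommutativeRing)
open import Data.Nat as ℕ using (ℕ; suc; _<_; NonZero)
open import Data.Nat.Primality using (Prime)
open import Relation.Binary.PropositionalEquality using (_≡_; _≢_)
open import Defs

-- The multiple n·1 is computed so
-- that the constants 0 and 1 evaluate to 0# and 1# on the nose, which
-- lets solver equations match goals that mention 0# and 1#.
module IntegerSolver (R : CommutativeRing 0ℓ 0ℓ) where
  open import Data.Nat as ℕ using (ℕ; zero; suc)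
  import Data.Nat.Properties as ℕP
  open import Data.Integer as ℤ using (ℤ; +_; -[1+_]; _⊖_; _◃_; sign; ∣_∣)
  import Data.Integer.Properties as ℤP
  open import Data.Sign as Sign using (Sign)
  open import Data.Maybe using (Maybe; just; nothing)
  open import Relation.Nullary using (yes; no)
  import Relation.Binary.PropositionalEquality as P
  open import Algebra.Solver.Ring.AlmostCommutativeRing
    using (_-Raw-AlmostCommutative⟶_; fromCommutativeRing)

  open CommutativeRing R
  open import Algebra.Properties.Ring ring using (-0#≈0#; -‿involutive; -1*x≈-x; -‿+-comm)
  open import Algebra.Properties.Semiring.Mult.TCOptimised semiring using (_×_; ×-homo-+; ×1-homo-*)
  open import Relation.Binary.Reasoning.Setoid setoid

  ι : ℕ → Carrier
  ι n = n × 1#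

  ⟦_⟧ℤ : ℤ → Carrier
  ⟦ + n ⟧ℤ     = ι n
  ⟦ -[1+ n ] ⟧ℤ = - ι (suc n)

  ι-suc : ∀ n → ι (suc n) ≈ 1# + ι n
  ι-suc n = ×-homo-+ 1# 1 n

  private

    1+a-[1+b]≈a-b : ∀ a b → (1# + a) - (1# + b) ≈ a - b
    1+a-[1+b]≈a-b a b = begin
      (1# + a) + - (1# + b)    ≈⟨ +-congˡ (sym (-‿+-comm 1# b)) ⟩
      (1# + a) + (- 1# + - b)  ≈⟨ +-assoc 1# a _ ⟩
      1# + (a + (- 1# + - b))  ≈⟨ +-congˡ (sym (+-assoc a (- 1#) (- b))) ⟩
      1# + ((a + - 1#) + - b)  ≈⟨ +-congˡ (+-congʳ (+-comm a (- 1#))) ⟩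
      1# + ((- 1# + a) + - b)  ≈⟨ +-congˡ (+-assoc (- 1#) a (- b)) ⟩
      1# + (- 1# + (a + - b))  ≈⟨ sym (+-assoc 1# (- 1#) _) ⟩
      (1# + - 1#) + (a + - b)  ≈⟨ +-congʳ (-‿inverseʳ 1#) ⟩
      0# + (a + - b)           ≈⟨ +-identityˡ _ ⟩
      a - b                    ∎

    ⊖-homo : ∀ m n → ⟦ m ⊖ n ⟧ℤ ≈ ι m - ι n
    ⊖-homo zero    zero    = sym (-‿inverseʳ 0#)
    ⊖-homo zero    (suc n) = sym (+-identityˡ _)
    ⊖-homo (suc m) zero    = sym (trans (+-congˡ -0#≈0#) (+-identityʳ _))
    ⊖-homo (suc m) (suc n) = begin
      ⟦ suc m ⊖ suc n ⟧ℤ     ≡⟨ P.cong ⟦_⟧ℤ (ℤP.[1+m]⊖[1+n]≡m⊖n m n) ⟩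
      ⟦ m ⊖ n ⟧ℤ             ≈⟨ ⊖-homo m n ⟩
      ι m - ι n              ≈⟨ sym (1+a-[1+b]≈a-b (ι m) (ι n)) ⟩
      (1# + ι m) - (1# + ι n) ≈⟨ sym (+-cong (ι-suc m) (-‿cong (ι-suc n))) ⟩
      ι (suc m) - ι (suc n)  ∎

    neg-homo : ∀ i → ⟦ ℤ.- i ⟧ℤ ≈ - ⟦ i ⟧ℤ
    neg-homo -[1+ n ]    = sym (-‿involutive _)
    neg-homo (+ zero)    = sym -0#≈0#
    neg-homo (+ suc n)   = refl

    +-homo : ∀ i j → ⟦ i ℤ.+ j ⟧ℤ ≈ ⟦ i ⟧ℤ + ⟦ j ⟧ℤ
    +-homo -[1+ m ] -[1+ n ] = begin
      - ι (suc (suc (m ℕ.+ n)))  ≡⟨ P.cong (λ k → - ι (suc k)) (P.sym (ℕP.+-suc m n)) ⟩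
      - ι (suc m ℕ.+ suc n)      ≈⟨ -‿cong (×-homo-+ 1# (suc m) (suc n)) ⟩
      - (ι (suc m) + ι (suc n))  ≈⟨ sym (-‿+-comm _ _) ⟩
      - ι (suc m) + - ι (suc n)  ∎
    +-homo -[1+ m ] (+ n)    = trans (⊖-homo n (suc m)) (+-comm _ _)
    +-homo (+ m)    -[1+ n ] = ⊖-homo m (suc n)
    +-homo (+ m)    (+ n)    = ×-homo-+ 1# m n

    σ : Sign → Carrier
    σ Sign.+ = 1#
    σ Sign.- = - 1#

    σ-homo : ∀ s t → σ (s Sign.* t) ≈ σ s * σ t
    σ-homo Sign.- Sign.- = sym (trans (-1*x≈-x (- 1#)) (-‿involutive 1#))
    σ-homo Sign.- Sign.+ = sym (*-identityʳ _)
    σ-homo Sign.+ t      = sym (*-identityˡ _)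

    ◃-homo : ∀ s n → ⟦ s ◃ n ⟧ℤ ≈ σ s * ι n
    ◃-homo s      zero    = sym (zeroʳ _)
    ◃-homo Sign.+ (suc n) = sym (*-identityˡ _)
    ◃-homo Sign.- (suc n) = sym (-1*x≈-x _)

    sign-magnitude : ∀ i → ⟦ i ⟧ℤ ≈ σ (sign i) * ι ∣ i ∣
    sign-magnitude -[1+ n ] = sym (-1*x≈-x _)
    sign-magnitude (+ n)    = sym (*-identityˡ _)

    interchange : ∀ a b c d → (a * b) * (c * d) ≈ (a * c) * (b * d)
    interchange a b c d = begin
      (a * b) * (c * d)  ≈⟨ *-assoc a b _ ⟩
      a * (b * (c * d))  ≈⟨ *-congˡ (sym (*-assoc b c d)) ⟩
      a * ((b * c) * d)  ≈⟨ *-congˡ (*-congʳ (*-comm b c)) ⟩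
      a * ((c * b) * d)  ≈⟨ *-congˡ (*-assoc c b d) ⟩
      a * (c * (b * d))  ≈⟨ sym (*-assoc a c _) ⟩
      (a * c) * (b * d)  ∎

    *-homo : ∀ i j → ⟦ i ℤ.* j ⟧ℤ ≈ ⟦ i ⟧ℤ * ⟦ j ⟧ℤ
    *-homo i j = begin
      ⟦ i ℤ.* j ⟧ℤ
        ≈⟨ ◃-homo (sign i Sign.* sign j) (∣ i ∣ ℕ.* ∣ j ∣) ⟩
      σ (sign i Sign.* sign j) * ι (∣ i ∣ ℕ.* ∣ j ∣)
        ≈⟨ *-cong (σ-homo (sign i) (sign j)) (×1-homo-* ∣ i ∣ ∣ j ∣) ⟩
      (σ (sign i) * σ (sign j)) * (ι ∣ i ∣ * ι ∣ j ∣)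
        ≈⟨ interchange _ _ _ _ ⟩
      (σ (sign i) * ι ∣ i ∣) * (σ (sign j) * ι ∣ j ∣)
        ≈⟨ *-cong (sym (sign-magnitude i)) (sym (sign-magnitude j)) ⟩
      ⟦ i ⟧ℤ * ⟦ j ⟧ℤ ∎

    ℤ-homomorphism : ℤ.+-*-rawRing -Raw-AlmostCommutative⟶ fromCommutativeRing R
    ℤ-homomorphism = record
      { ⟦_⟧ = ⟦_⟧ℤ ; +-homo = +-homo ; *-homo = *-homo ; -‿homo = neg-homo
      ; 0-homo = refl ; 1-homo = refl }

    coefficient-test : ∀ a b → Maybe (⟦ a ⟧ℤ ≈ ⟦ b ⟧ℤ)
    coefficient-test a b with a ℤ.≟ b
    ... | yes P.refl = just refl
    ... | no _       = nothing

  open import Algebra.Solver.Ring ℤ.+-*-rawRing (fromCommutativeRing R) ℤ-homomorphism coefficient-test public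

module OddPowers where
  open import Data.Nat as ℕ using (ℕ; zero; suc; _+_; _*_; _^_; _∸_; _/_; _<_; _≤_; z≤n; NonZero)
  import Data.Nat.Properties as ℕP
  open import Data.Nat.Primality using (Prime; composite; prime⇒¬composite; ¬prime[1])
  open import Data.Nat.Divisibility using (divides)
  open import Data.Nat.DivMod using (m*n/n≡m)
  open import Data.Nat.Tactic.RingSolver using (solve-∀)
  open import Data.Product using (∃; _,_)
  open import Data.Sum using (_⊎_; inj₁; inj₂)
  open import Data.Empty using (⊥-elim)
  open import Relation.Binary.PropositionalEquality using (_≡_; refl; cong; cong₂; sym; trans)

  parity : ∀ m → (∃ λ j → m ≡ j + j) ⊎ (∃ λ j → m ≡ suc (j + j))
  parity zero    = inj₁ (0 , refl)
  parity (suc m) with parity m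
  ... | inj₁ (j , m≡2j)   = inj₂ (j , cong suc m≡2j)
  ... | inj₂ (j , m≡2j+1) = inj₁ (suc j , trans (cong suc m≡2j+1) (cong suc (sym (ℕP.+-suc j j))))

  odd-prime-power : ∀ {p} → Prime p → 2 < p → ∀ l → ∃ λ m → p ^ l ≡ suc (m + m)
  odd-prime-power {p} pr 2<p with parity p
  ... | inj₁ (j , p≡2j) = ⊥-elim (prime⇒¬composite pr (composite 2<p (divides j (trans p≡2j (j+j≡j*2 j)))))
    where
    j+j≡j*2 : ∀ j → j + j ≡ j * 2
    j+j≡j*2 = solve-∀
  ... | inj₂ (a , p≡2a+1) = odd-power
    where
    product-odd : ∀ a b → suc (a + a) * suc (b + b) ≡ suc ((a + b + 2 * a * b) + (a + b + 2 * a * b))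
    product-odd = solve-∀
    odd-power : ∀ l → ∃ λ m → p ^ l ≡ suc (m + m)
    odd-power zero    = 0 , refl
    odd-power (suc l) with odd-power l
    ... | b , pˡ≡2b+1 = a + b + 2 * a * b , trans (cong₂ _*_ p≡2a+1 pˡ≡2b+1) (product-odd a b)

  half-nonzero : ∀ {p l m} → Prime p → 1 ≤ l → p ^ l ≡ suc (m + m) → NonZero m
  half-nonzero {m = suc m} _ _ _ = _
  half-nonzero {p} {l} {zero} pr 1≤l pˡ≡1 with ℕP.m^n≡1⇒n≡0∨m≡1 p l pˡ≡1
  ... | inj₁ refl = ⊥-elim (ℕP.<⇒≱ 1≤l z≤n)
  ... | inj₂ refl = ⊥-elim (¬prime[1] pr)

  ⌈half⌉ : ∀ m → (suc (m + m) + 1) / 2 ≡ suc m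
  ⌈half⌉ m = trans (cong (_/ 2) (lemma m)) (m*n/n≡m (suc m) 2)
    where
    lemma : ∀ m → suc (m + m) + 1 ≡ suc m * 2
    lemma = solve-∀

  ⌊half⌋ : ∀ m → (suc (m + m) ∸ 1) / 2 ≡ m
  ⌊half⌋ m = trans (cong (_/ 2) (lemma m)) (m*n/n≡m m 2)
    where
    lemma : ∀ m → m + m ≡ m * 2
    lemma = solve-∀

module Frobenius where
  open import Data.Nat as ℕ using (ℕ; zero; suc; _∸_; _!; _<_; s≤s; z≤n; NonZero)
  import Data.Nat.Properties as ℕP
  open import Data.Nat.Combinatorics using (_C_; nCn≡1; nCk≡n!/k![n-k]!; k![n∸k]!∣n!)
  open import Data.Nat.Divisibility using (_∣_; divides; ∣1⇒≡1; ∣⇒≤)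
  open import Data.Nat.DivMod using (m*[n/m]≡n; _/_)
  open import Data.Nat.Primality using (Prime; euclidsLemma; prime⇒nonZero; ¬prime[1])
  open import Data.Fin as Fin using (toℕ)
  import Data.Fin.Properties as FinP
  open import Data.Vec.Functional using (init; tail; last)
  open import Data.Sum using (inj₁; inj₂)
  open import Data.Empty using (⊥-elim)
  open import Relation.Nullary using (¬_)
  open import Relation.Binary.PropositionalEquality as P using (_≡_)

  prime∤! : ∀ {p} → Prime p → ∀ m → m < p → ¬ p ∣ m !
  prime∤! pr zero    _   p∣1 with ∣1⇒≡1 p∣1
  ... | P.refl = ¬prime[1] pr
  prime∤! pr (suc m) m<p p∣m! with euclidsLemma (suc m) (m !) pr p∣m!
  ... | inj₁ p∣1+m = ℕP.<⇒≱ m<p (∣⇒≤ p∣1+m)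
  ... | inj₂ p∣m!  = prime∤! pr m (ℕP.<-trans (ℕP.n<1+n m) m<p) p∣m!

  -- p divides p C k for 0 < k < p: (p C k) · k! · (p - k)! = p!, and p
  -- divides neither k! nor (p - k)!
  prime∣choose : ∀ {p} → Prime p → ∀ k → 0 < k → k < p → p ∣ p C k
  prime∣choose {p} pr k 0<k k<p
    with euclidsLemma (p C k) (k ! ℕ.* (p ∸ k) !) pr p∣product
    where
    instance _ = ℕP._!*_!≢0 k (p ∸ k)
    product≡p! : (p C k) ℕ.* (k ! ℕ.* (p ∸ k) !) ≡ p !
    product≡p! = P.trans (P.cong (ℕ._* (k ! ℕ.* (p ∸ k) !)) (nCk≡n!/k![n-k]! (ℕP.<⇒≤ k<p)))
                   (P.trans (ℕP.*-comm (p ! / (k ! ℕ.* (p ∸ k) !)) _) (m*[n/m]≡n (k![n∸k]!∣n! (ℕP.<⇒≤ k<p))))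
    n∣n! : ∀ n → .{{NonZero n}} → n ∣ n !
    n∣n! (suc n) = divides (n !) (ℕP.*-comm (suc n) (n !))
    p∣product : p ∣ (p C k) ℕ.* (k ! ℕ.* (p ∸ k) !)
    p∣product = P.subst (p ∣_) (P.sym product≡p!) (n∣n! p {{prime⇒nonZero pr}})
  ... | inj₁ p∣pCk = p∣pCk
  ... | inj₂ p∣k![p-k]! with euclidsLemma (k !) ((p ∸ k) !) pr p∣k![p-k]!
  ... | inj₁ p∣k!     = ⊥-elim (prime∤! pr k k<p p∣k!)
  ... | inj₂ p∣[p-k]! = ⊥-elim (prime∤! pr (p ∸ k) (ℕP.∸-monoʳ-< 0<k (ℕP.<⇒≤ k<p)) p∣[p-k]!)

  module _ (R : CommutativeRing 0ℓ 0ℓ) where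
    open CommutativeRing R
    open import Algebra.Properties.Semiring.Mult semiring using (_×_)
    open import Algebra.Properties.Semiring.Exp semiring using (_^_)
    open import Algebra.Properties.Semiring.Sum semiring using (sum; sum-init-last; sum-cong-≋; sum-replicate-zero)
    open import Algebra.Properties.CommutativeSemiring.Binomial commutativeSemiring using (theorem; binomialTerm)
    open import Relation.Binary.Reasoning.Setoid setoid

    binomial-collapse : ∀ n → (∀ k → 0 < k → k < suc n → ∀ z → (suc n C k) × z ≈ 0#) →
                        ∀ a b → (a + b) ^ suc n ≈ a ^ suc n + b ^ suc n
    binomial-collapse n inner-vanishes a b = begin
      (a + b) ^ suc n                                     ≈⟨ theorem (suc n) a b ⟩
      t Fin.zero + sum (tail t)                           ≈⟨ +-congˡ (sum-init-last (tail t)) ⟩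
      t Fin.zero + (sum (init (tail t)) + last (tail t))  ≈⟨ +-cong first (+-cong inner-sum final) ⟩
      b ^ suc n + (0# + a ^ suc n)                        ≈⟨ +-congˡ (+-identityˡ _) ⟩
      b ^ suc n + a ^ suc n                               ≈⟨ +-comm _ _ ⟩
      a ^ suc n + b ^ suc n                               ∎
      where
      t = binomialTerm a b (suc n)
      first : t Fin.zero ≈ b ^ suc n
      first = trans (+-identityʳ _) (*-identityˡ _)
      inner-sum : sum (init (tail t)) ≈ 0#
      inner-sum = trans (sum-cong-≋ λ j → inner-vanishes _ (s≤s z≤n)
                          (s≤s (P.subst (ℕ._< n) (P.sym (FinP.toℕ-inject₁ j)) (FinP.toℕ<n j))) _)
                        (sum-replicate-zero n)
      final : last (tail t) ≈ a ^ suc n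
      final = begin
        (suc n C suc (toℕ (Fin.fromℕ n))) × (a ^ suc (toℕ (Fin.fromℕ n)) * b ^ (suc n ∸ suc (toℕ (Fin.fromℕ n))))
          ≡⟨ P.cong (λ k → (suc n C suc k) × (a ^ suc k * b ^ (suc n ∸ suc k))) (FinP.toℕ-fromℕ n) ⟩
        (suc n C suc n) × (a ^ suc n * b ^ (suc n ∸ suc n))
          ≡⟨ P.cong₂ (λ c e → c × (a ^ suc n * b ^ e)) (nCn≡1 (suc n)) (ℕP.n∸n≡0 n) ⟩
        1 × (a ^ suc n * 1#)   ≈⟨ +-identityʳ _ ⟩
        a ^ suc n * 1#         ≈⟨ *-identityʳ _ ⟩
        a ^ suc n              ∎

  module Map (R : CommutativeRing 0ℓ 0ℓ) {p : ℕ} (pr : Prime p)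
             (char : CommutativeRing._≈_ R (IntegerSolver.ι R p) (CommutativeRing.0# R)) where
    open CommutativeRing R
    open IntegerSolver R using (ι; ι-suc)
    open import Algebra.Properties.Semiring.Mult semiring using (_×_; ×-congʳ; ×-assoc-*; ×-assocˡ)
    open import Algebra.Properties.Semiring.Mult.TCOptimised semiring using (×ᵤ≈×)
    open import Algebra.Properties.Semiring.Exp semiring using (_^_; ^-congˡ; ^-assocʳ)
    open import Relation.Binary.Reasoning.Setoid setoid

    multiple-annihilates : ∀ n z → p ∣ n → n × z ≈ 0#
    multiple-annihilates _ z (divides c P.refl) = begin
      (c ℕ.* p) × z      ≈⟨ sym (×-assocˡ z c p) ⟩
      c × (p × z)        ≈⟨ ×-congʳ c p×z≈0 ⟩
      c × 0#             ≈⟨ c×0≈0 c ⟩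
      0#                 ∎
      where
      p×z≈0 : p × z ≈ 0#
      p×z≈0 = begin
        p × z            ≈⟨ ×-congʳ p (sym (*-identityˡ z)) ⟩
        p × (1# * z)     ≈⟨ sym (×-assoc-* p 1# z) ⟩
        (p × 1#) * z     ≈⟨ *-congʳ (trans (×ᵤ≈× p 1#) char) ⟩
        0# * z           ≈⟨ zeroˡ z ⟩
        0#               ∎
      c×0≈0 : ∀ c → c × 0# ≈ 0#
      c×0≈0 zero    = refl
      c×0≈0 (suc c) = trans (+-identityˡ _) (c×0≈0 c)

    frobenius-+ : ∀ a b → (a + b) ^ p ≈ a ^ p + b ^ p
    frobenius-+ = P.subst (λ n → ∀ a b → (a + b) ^ n ≈ a ^ n + b ^ n) 1+p′≡p
      (binomial-collapse R p′ λ k 0<k k<1+p′ z → multiple-annihilates _ z (p∣[1+p′]Ck k 0<k k<1+p′))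
      where
      p′ = ℕ.pred p
      1+p′≡p : suc p′ ≡ p
      1+p′≡p = ℕP.suc-pred p {{prime⇒nonZero pr}}
      p∣[1+p′]Ck : ∀ k → 0 < k → k < suc p′ → p ∣ suc p′ C k
      p∣[1+p′]Ck k 0<k k<1+p′ = P.subst (λ n → p ∣ n C k) (P.sym 1+p′≡p)
        (prime∣choose pr k 0<k (P.subst (k <_) 1+p′≡p k<1+p′))

    module _ (l : ℕ) where
      private q = p ℕ.^ l

      frobenius-iterated-+ : ∀ a b → (a + b) ^ q ≈ a ^ q + b ^ q
      frobenius-iterated-+ = iterate l
        where
        iterate : ∀ l a b → (a + b) ^ (p ℕ.^ l) ≈ a ^ (p ℕ.^ l) + b ^ (p ℕ.^ l)
        iterate zero    a b = trans (*-identityʳ _) (+-cong (sym (*-identityʳ _)) (sym (*-identityʳ _)))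
        iterate (suc l) a b = begin
          (a + b) ^ (p ℕ.* p ℕ.^ l)                  ≈⟨ sym (^-assocʳ (a + b) p (p ℕ.^ l)) ⟩
          ((a + b) ^ p) ^ (p ℕ.^ l)                  ≈⟨ ^-congˡ (p ℕ.^ l) (frobenius-+ a b) ⟩
          (a ^ p + b ^ p) ^ (p ℕ.^ l)                ≈⟨ iterate l _ _ ⟩
          (a ^ p) ^ (p ℕ.^ l) + (b ^ p) ^ (p ℕ.^ l)  ≈⟨ +-cong (^-assocʳ a p _) (^-assocʳ b p _) ⟩
          a ^ (p ℕ.* p ℕ.^ l) + b ^ (p ℕ.* p ℕ.^ l)  ∎

      -- k · 1 is fixed: 0 ^ q = 0 as q > 0, and induction using additivity
      frobenius-fixes-ι : ∀ k → ι k ^ q ≈ ι k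
      frobenius-fixes-ι zero    with q | ℕP.m^n>0 p {{prime⇒nonZero pr}} l
      ... | suc q′ | _ = zeroˡ _
      frobenius-fixes-ι (suc k) = begin
        ι (suc k) ^ q       ≈⟨ ^-congˡ q (ι-suc k) ⟩
        (1# + ι k) ^ q      ≈⟨ frobenius-iterated-+ 1# (ι k) ⟩
        1# ^ q + ι k ^ q    ≈⟨ +-cong (1^n≈1 q) (frobenius-fixes-ι k) ⟩
        1# + ι k            ≈⟨ sym (ι-suc k) ⟩
        ι (suc k)           ∎
        where
        1^n≈1 : ∀ n → 1# ^ n ≈ 1#
        1^n≈1 zero    = refl
        1^n≈1 (suc n) = trans (*-identityˡ _) (1^n≈1 n)

      -- additivity also gives compatibility with negation
      frobenius-- : ∀ a → (- a) ^ q ≈ - (a ^ q)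
      frobenius-- a = begin
        (- a) ^ q                          ≈⟨ sym (+-identityˡ _) ⟩
        0# + (- a) ^ q                     ≈⟨ +-congʳ (sym (-‿inverseˡ (a ^ q))) ⟩
        (- (a ^ q) + a ^ q) + (- a) ^ q    ≈⟨ +-assoc _ _ _ ⟩
        - (a ^ q) + (a ^ q + (- a) ^ q)    ≈⟨ +-congˡ (sym (frobenius-iterated-+ a (- a))) ⟩
        - (a ^ q) + (a + - a) ^ q          ≈⟨ +-congˡ (^-congˡ q (-‿inverseʳ a)) ⟩
        - (a ^ q) + ι 0 ^ q                ≈⟨ +-congˡ (frobenius-fixes-ι 0) ⟩
        - (a ^ q) + 0#                     ≈⟨ +-identityʳ _ ⟩
        - (a ^ q)                          ∎

-- For a commutative ring R and x ∈ R, the ring R[θ] = R[Y]/(Y² - Y + x)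
-- of pairs (a , b) standing for a + bθ, where θ² = θ - x.  The root θ
-- satisfies the characteristic equation of the recurrence
-- D(n+2) = D(n+1) - x D(n) defining the Dickson polynomials.
module RootExtension (R : CommutativeRing 0ℓ 0ℓ) (x : CommutativeRing.Carrier R) where
  open import Data.Product using (_×_; _,_)
  open import Relation.Binary.Structures using (IsEquivalence)
  open import Algebra.Structures using (IsCommutativeRing)

  open CommutativeRing R
  open IntegerSolver R using (solve; _:=_; _:+_; _:*_; _:-_; con)
  open import Data.Integer using (+_)

  Pair : Set
  Pair = Carrier × Carrier

  infix  4 _≈ₑ_
  infixl 6 _+ₑ_
  infixl 7 _*ₑ_
  infix  8 -ₑ_

  _≈ₑ_ : Pair → Pair → Set
  (a , b) ≈ₑ (c , d) = (a ≈ c) × (b ≈ d)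

  _+ₑ_ : Pair → Pair → Pair
  (a , b) +ₑ (c , d) = (a + c , b + d)

  -- (a + bθ)(c + dθ) = ac + (ad + bc)θ + bd(θ - x)
  _*ₑ_ : Pair → Pair → Pair
  (a , b) *ₑ (c , d) = (a * c - x * (b * d) , a * d + b * c + b * d)

  -ₑ_ : Pair → Pair
  -ₑ (a , b) = (- a , - b)

  0ₑ 1ₑ θ : Pair
  0ₑ = (0# , 0#)
  1ₑ = (1# , 0#)
  θ  = (0# , 1#)

  emb : Carrier → Pair
  emb a = (a , 0#)

  private
    *ₑ-assoc : ∀ u v w → (u *ₑ v) *ₑ w ≈ₑ u *ₑ (v *ₑ w)
    *ₑ-assoc (a , b) (c , d) (e , f) =
        solve 7 (λ x a b c d e f →
          (a :* c :- x :* (b :* d)) :* e :- x :* ((a :* d :+ b :* c :+ b :* d) :* f)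
          := a :* (c :* e :- x :* (d :* f)) :- x :* (b :* (c :* f :+ d :* e :+ d :* f)))
          refl x a b c d e f
      , solve 7 (λ x a b c d e f →
          (a :* c :- x :* (b :* d)) :* f :+ (a :* d :+ b :* c :+ b :* d) :* e
            :+ (a :* d :+ b :* c :+ b :* d) :* f
          := a :* (c :* f :+ d :* e :+ d :* f) :+ b :* (c :* e :- x :* (d :* f))
            :+ b :* (c :* f :+ d :* e :+ d :* f))
          refl x a b c d e f

    *ₑ-comm : ∀ u v → u *ₑ v ≈ₑ v *ₑ u
    *ₑ-comm (a , b) (c , d) =
        solve 5 (λ x a b c d → a :* c :- x :* (b :* d) := c :* a :- x :* (d :* b)) refl x a b c d
      , solve 4 (λ a b c d → a :* d :+ b :* c :+ b :* d := c :* b :+ d :* a :+ d :* b) refl a b c d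

    *ₑ-identityˡ : ∀ u → 1ₑ *ₑ u ≈ₑ u
    *ₑ-identityˡ (a , b) =
        solve 3 (λ x a b → con (+ 1) :* a :- x :* (con (+ 0) :* b) := a) refl x a b
      , solve 2 (λ a b → con (+ 1) :* b :+ con (+ 0) :* a :+ con (+ 0) :* b := b) refl a b

    *ₑ-identityʳ : ∀ u → u *ₑ 1ₑ ≈ₑ u
    *ₑ-identityʳ u = trans×trans (*ₑ-comm u 1ₑ) (*ₑ-identityˡ u)
      where
      trans×trans : ∀ {u v w} → u ≈ₑ v → v ≈ₑ w → u ≈ₑ w
      trans×trans (p , q) (r , s) = trans p r , trans q s

    *ₑ-distribˡ : ∀ u v w → u *ₑ (v +ₑ w) ≈ₑ u *ₑ v +ₑ u *ₑ w
    *ₑ-distribˡ (a , b) (c , d) (e , f) =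
        solve 7 (λ x a b c d e f →
          a :* (c :+ e) :- x :* (b :* (d :+ f))
          := (a :* c :- x :* (b :* d)) :+ (a :* e :- x :* (b :* f)))
          refl x a b c d e f
      , solve 6 (λ a b c d e f →
          a :* (d :+ f) :+ b :* (c :+ e) :+ b :* (d :+ f)
          := (a :* d :+ b :* c :+ b :* d) :+ (a :* f :+ b :* e :+ b :* f))
          refl a b c d e f

    *ₑ-distribʳ : ∀ u v w → (v +ₑ w) *ₑ u ≈ₑ v *ₑ u +ₑ w *ₑ u
    *ₑ-distribʳ (a , b) (c , d) (e , f) =
        solve 7 (λ x a b c d e f →
          (c :+ e) :* a :- x :* ((d :+ f) :* b)
          := (c :* a :- x :* (d :* b)) :+ (e :* a :- x :* (f :* b)))
          refl x a b c d e f
      , solve 6 (λ a b c d e f →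
          (c :+ e) :* b :+ (d :+ f) :* a :+ (d :+ f) :* b
          := (c :* b :+ d :* a :+ d :* b) :+ (e :* b :+ f :* a :+ f :* b))
          refl a b c d e f

    ≈ₑ-isEquivalence : IsEquivalence _≈ₑ_
    ≈ₑ-isEquivalence = record
      { refl  = refl , refl
      ; sym   = λ (p , q) → sym p , sym q
      ; trans = λ (p , q) (r , s) → trans p r , trans q s }

    isCommutativeRingₑ : IsCommutativeRing _≈ₑ_ _+ₑ_ _*ₑ_ -ₑ_ 0ₑ 1ₑ
    isCommutativeRingₑ = record
      { isRing = record
        { +-isAbelianGroup = record
          { isGroup = record
            { isMonoid = record
              { isSemigroup = record
                { isMagma = record
                  { isEquivalence = ≈ₑ-isEquivalence
                  ; ∙-cong = λ (p , q) (r , s) → +-cong p r , +-cong q s }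
                ; assoc = λ (a , b) (c , d) (e , f) → +-assoc a c e , +-assoc b d f }
              ; identity = (λ (a , b) → +-identityˡ a , +-identityˡ b)
                         , (λ (a , b) → +-identityʳ a , +-identityʳ b) }
            ; inverse = (λ (a , b) → -‿inverseˡ a , -‿inverseˡ b)
                      , (λ (a , b) → -‿inverseʳ a , -‿inverseʳ b)
            ; ⁻¹-cong = λ (p , q) → -‿cong p , -‿cong q }
          ; comm = λ (a , b) (c , d) → +-comm a c , +-comm b d }
        ; *-cong = λ (p , q) (r , s) →
            +-cong (*-cong p r) (-‿cong (*-congˡ (*-cong q s)))
          , +-cong (+-cong (*-cong p s) (*-cong q r)) (*-cong q s)
        ; *-assoc = *ₑ-assoc
        ; *-identity = *ₑ-identityˡ , *ₑ-identityʳ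
        ; distrib = *ₑ-distribˡ , *ₑ-distribʳ }
      ; *-comm = *ₑ-comm }

  extension : CommutativeRing 0ℓ 0ℓ
  extension = record { isCommutativeRing = isCommutativeRingₑ }

module FieldBasics {n : ℕ} (F : FiniteField n) where
  open import Data.Nat using (zero; suc)
  open import Data.Fin as Fin using (Fin)
  open import Data.Fin.Permutation using (Permutation; _⟨$⟩ʳ_)
  open import Data.Product using (_,_)
  open import Function.Bundles using (Inverse; mk↔ₛ′)
  open import Relation.Nullary using (¬_; Dec; yes; no)
  import Relation.Binary.PropositionalEquality as P

  open FiniteField F
  open IntegerSolver cring using (ι; ι-suc)
  open import Algebra.Properties.Semiring.Mult.TCOptimised semiring using (×ᵤ≈×)
  open import Algebra.Properties.Semiring.Exp semiring using (_^_)
  open import Algebra.Properties.CommutativeMonoid.Sum +-commutativeMonoid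
    using (sum; sum-replicate; ∑-distrib-+; sum-cong-≋; sum-permute)
  open import Relation.Binary.Reasoning.Setoid setoid
  open Inverse card using (to; from; to-cong; inverseˡ; inverseʳ)

  fromℕ≈ι : ∀ k → fromℕ F k ≈ ι k
  fromℕ≈ι zero    = refl
  fromℕ≈ι (suc k) = trans (+-congˡ (fromℕ≈ι k)) (sym (ι-suc k))

  pow≈^ : ∀ a k → pow F a k ≈ a ^ k
  pow≈^ a zero    = refl
  pow≈^ a (suc k) = *-congˡ (pow≈^ a k)

  _≟_ : ∀ a b → Dec (a ≈ b)
  a ≟ b with to a Fin.≟ to b
  ... | yes eq = yes (begin
        a             ≈⟨ sym (inverseʳ P.refl) ⟩
        from (to a)   ≡⟨ P.cong from eq ⟩
        from (to b)   ≈⟨ inverseʳ P.refl ⟩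
        b             ∎)
  ... | no ne  = no (λ a≈b → ne (to-cong a≈b))

  -- n · 1 = 0: translating by 1 permutes F, so the sum S of all elements
  -- satisfies S + n·1 = S.
  card-annihilates : ι n ≈ 0#
  card-annihilates = begin
    ι n                                   ≈⟨ sym (+-identityˡ _) ⟩
    0# + ι n                              ≈⟨ +-congʳ (sym (-‿inverseˡ S)) ⟩
    (- S + S) + ι n                       ≈⟨ +-assoc _ _ _ ⟩
    - S + (S + ι n)                       ≈⟨ +-congˡ (+-congˡ (sym (trans (sum-replicate n) (×ᵤ≈× n 1#)))) ⟩
    - S + (S + sum {n} (λ _ → 1#))        ≈⟨ +-congˡ (sym (∑-distrib-+ from (λ _ → 1#))) ⟩
    - S + sum (λ i → from i + 1#)         ≈⟨ +-congˡ (sym (sum-cong-≋ {n} {λ i → from (shift ⟨$⟩ʳ i)}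
                                                                       (λ i → inverseʳ P.refl))) ⟩
    - S + sum (λ i → from (shift ⟨$⟩ʳ i)) ≈⟨ +-congˡ (sym (sum-permute from shift)) ⟩
    - S + S                               ≈⟨ -‿inverseˡ S ⟩
    0#                                    ∎
    where
    S = sum from
    shift : Permutation n n
    shift = mk↔ₛ′ (λ i → to (from i + 1#)) (λ i → to (from i - 1#)) up-down down-up
      where
      up-down : ∀ i → to (from (to (from i - 1#)) + 1#) P.≡ i
      up-down i = P.trans (to-cong (begin
        from (to (from i - 1#)) + 1#  ≈⟨ +-congʳ (inverseʳ P.refl) ⟩
        (from i - 1#) + 1#            ≈⟨ +-assoc _ _ _ ⟩
        from i + (- 1# + 1#)          ≈⟨ +-congˡ (-‿inverseˡ 1#) ⟩
        from i + 0#                   ≈⟨ +-identityʳ _ ⟩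
        from i                        ∎)) (inverseˡ refl)
      down-up : ∀ i → to (from (to (from i + 1#)) - 1#) P.≡ i
      down-up i = P.trans (to-cong (begin
        from (to (from i + 1#)) - 1#  ≈⟨ +-congʳ (inverseʳ P.refl) ⟩
        (from i + 1#) - 1#            ≈⟨ +-assoc _ _ _ ⟩
        from i + (1# - 1#)            ≈⟨ +-congˡ (-‿inverseʳ 1#) ⟩
        from i + 0#                   ≈⟨ +-identityʳ _ ⟩
        from i                        ∎)) (inverseˡ refl)

  *-cancelˡ : ∀ a b c → ¬ a ≈ 0# → a * b ≈ a * c → b ≈ c
  *-cancelˡ a b c a≉0 ab≈ac with inverse a a≉0
  ... | a⁻¹ , aa⁻¹≈1 = begin
    b                ≈⟨ sym (*-identityˡ b) ⟩
    1# * b           ≈⟨ *-congʳ (trans (sym aa⁻¹≈1) (*-comm a a⁻¹)) ⟩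
    (a⁻¹ * a) * b    ≈⟨ *-assoc _ _ _ ⟩
    a⁻¹ * (a * b)    ≈⟨ *-congˡ ab≈ac ⟩
    a⁻¹ * (a * c)    ≈⟨ sym (*-assoc _ _ _) ⟩
    (a⁻¹ * a) * c    ≈⟨ *-congʳ (trans (*-comm a⁻¹ a) aa⁻¹≈1) ⟩
    1# * c           ≈⟨ *-identityˡ c ⟩
    c                ∎

  *-nonzero : ∀ a b → ¬ a ≈ 0# → ¬ b ≈ 0# → ¬ a * b ≈ 0#
  *-nonzero a b a≉0 b≉0 ab≈0 = b≉0 (*-cancelˡ a b 0# a≉0 (trans ab≈0 (sym (zeroʳ a))))

  ^-nonzero : ∀ a k → ¬ a ≈ 0# → ¬ a ^ k ≈ 0#
  ^-nonzero a zero    a≉0 1≈0 = 0≉1 (sym 1≈0)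
  ^-nonzero a (suc k) a≉0     = *-nonzero a (a ^ k) a≉0 (^-nonzero a k a≉0)

module PrimeCharacteristic (p e : ℕ) (pr : Prime p) (F : FiniteField (p ℕ.^ e)) where
  open import Data.Nat using (zero; suc)
  open import Data.Nat.Divisibility using (_∣_; _∣?_)
  open import Data.Nat.Primality using (prime⇒irreducible)
  open import Data.Nat.Coprimality using (Coprime; coprime-Bézout)
  open import Data.Nat.GCD using (module Bézout)
  open import Data.Product using (_,_)
  open import Data.Sum using (inj₁; inj₂)
  open import Data.Empty using (⊥; ⊥-elim)
  open import Relation.Nullary using (yes; no)
  open import Relation.Binary.PropositionalEquality as P using (_≡_)

  open FiniteField F
  open IntegerSolver cring using (ι)
  open FieldBasics F using (_≟_; card-annihilates; ^-nonzero)
  open import Algebra.Properties.Semiring.Mult.TCOptimised semiring using (×-homo-+; ×1-homo-*)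
  open import Algebra.Properties.Semiring.Exp semiring using (_^_)
  open import Relation.Binary.Reasoning.Setoid setoid

  ι-^ : ∀ a k → ι (a ℕ.^ k) ≈ ι a ^ k
  ι-^ a zero    = refl
  ι-^ a (suc k) = trans (×1-homo-* a (a ℕ.^ k)) (*-congˡ (ι-^ a k))

  -- p · 1 = 0, since (p · 1) ^ e = p ^ e · 1 = 0 and F has no zero divisors
  char : ι p ≈ 0#
  char with ι p ≟ 0#
  ... | yes ιp≈0 = ιp≈0
  ... | no  ιp≉0 = ⊥-elim (^-nonzero (ι p) e ιp≉0 (trans (sym (ι-^ p e)) card-annihilates))

  private
    no-unit-relation : ∀ a b c d → ι b ≈ 0# → ι d ≈ 0# → 1 ℕ.+ a ℕ.* b ≡ c ℕ.* d → ⊥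
    no-unit-relation a b c d ιb≈0 ιd≈0 eq = 0≉1 (sym (begin
      1#                       ≈⟨ sym (+-identityʳ 1#) ⟩
      1# + 0#                  ≈⟨ +-congˡ (sym (trans (*-congˡ ιb≈0) (zeroʳ _))) ⟩
      1# + ι a * ι b           ≈⟨ +-congˡ (sym (×1-homo-* a b)) ⟩
      1# + ι (a ℕ.* b)         ≈⟨ sym (×-homo-+ 1# 1 (a ℕ.* b)) ⟩
      ι (1 ℕ.+ a ℕ.* b)        ≡⟨ P.cong ι eq ⟩
      ι (c ℕ.* d)              ≈⟨ ×1-homo-* c d ⟩
      ι c * ι d                ≈⟨ *-congˡ ιd≈0 ⟩
      ι c * 0#                 ≈⟨ zeroʳ _ ⟩
      0#                       ∎))

  -- k · 1 = 0 only for multiples k of p: otherwise k is coprime to p and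
  -- Bézout's identity yields 1 = 0
  ι≈0⇒∣ : ∀ k → ι k ≈ 0# → p ∣ k
  ι≈0⇒∣ k ιk≈0 with p ∣? k
  ... | yes p∣k = p∣k
  ... | no  p∤k with coprime-Bézout coprime
    where
    coprime : Coprime p k
    coprime (d∣p , d∣k) with prime⇒irreducible pr d∣p
    ... | inj₁ d≡1    = d≡1
    ... | inj₂ P.refl = ⊥-elim (p∤k d∣k)
  ... | Bézout.+- a b eq = ⊥-elim (no-unit-relation b k a p ιk≈0 char eq)
  ... | Bézout.-+ a b eq = ⊥-elim (no-unit-relation a p b k char ιk≈0 eq)

-- Work in R[θ], θ² = θ - x, where θ ^ (n+1) = -x D(n) + D(n+1) θ.  The
-- element s = 2θ - 1 has s² = 1 - 4x, so s ^ q = (1 - 4x) ^ m s, while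
-- the Frobenius map gives s ^ q = 2 θ ^ q - 1.  Hence
-- 2 θ ^ (q+3) = (1 + (1 - 4x) ^ m s) θ³, and comparing θ-coordinates
-- gives the formula.
module DicksonClosedForm (p e l m : ℕ) (pr : Prime p) (F : FiniteField (p ℕ.^ e))
                         (q-odd : p ℕ.^ l ≡ suc (m ℕ.+ m)) where
  open import Data.Nat using (zero)
  import Data.Nat.Properties as ℕP
  open import Data.Integer using (+_)
  open import Data.Product using (_,_; proj₁; proj₂)
  import Relation.Binary.PropositionalEquality as P

  open FiniteField F
  open IntegerSolver cring using (ι; ι-suc; solve; _:=_; _:+_; _:*_; _:-_; :-_; con)
  open import Algebra.Properties.Semiring.Exp semiring using (_^_)
  open PrimeCharacteristic p e pr F using (char)
  open import Relation.Binary.Reasoning.Setoid setoid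
  import Relation.Binary.Reasoning.Setoid as SetoidReasoning

  module _ (x : Carrier) where
    open RootExtension cring x
    module E = CommutativeRing extension
    open IntegerSolver extension using () renaming (ι to ιₑ; ι-suc to ιₑ-suc)
    open import Algebra.Properties.Semiring.Exp E.semiring using ()
      renaming (_^_ to _^ₑ_; ^-congˡ to ^ₑ-congˡ; ^-congʳ to ^ₑ-congʳ; ^-homo-* to ^ₑ-homo-*)
    open import Algebra.Properties.CommutativeSemiring.Exp E.commutativeSemiring using ()
      renaming (^-distrib-* to ^ₑ-distrib-*)
    module ER = SetoidReasoning E.setoid

    private
      q = p ℕ.^ l

    -- the multiples of 1 in R[θ] are the embedded multiples of 1 in R, so
    -- R[θ] has characteristic p as well and its Frobenius maps are available
    ιₑ≈emb : ∀ k → ιₑ k ≈ₑ emb (ι k)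
    ιₑ≈emb zero    = refl , refl
    ιₑ≈emb (suc k) = E.trans (ιₑ-suc k)
      (trans (+-congˡ (proj₁ (ιₑ≈emb k))) (sym (ι-suc k)) , trans (+-identityˡ _) (proj₂ (ιₑ≈emb k)))

    open Frobenius.Map extension pr (E.trans (ιₑ≈emb p) (char , refl))
      using (frobenius-iterated-+; frobenius-fixes-ι; frobenius--)

    emb-^ : ∀ a k → emb a ^ₑ k ≈ₑ emb (a ^ k)
    emb-^ a zero    = refl , refl
    emb-^ a (suc k) = E.trans (E.*-congˡ (emb-^ a k))
      ( solve 3 (λ x a b → a :* b :- x :* (con (+ 0) :* con (+ 0)) := a :* b) refl x a (a ^ k)
      , solve 2 (λ a b → a :* con (+ 0) :+ con (+ 0) :* b :+ con (+ 0) :* con (+ 0) := con (+ 0)) refl a (a ^ k))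

    θ-powers : ∀ n → θ ^ₑ suc n ≈ₑ (- (x * D F n 2 x) , D F (suc n) 2 x)
    θ-powers zero =
        solve 2 (λ x t → con (+ 0) :* con (+ 1) :- x :* (con (+ 1) :* con (+ 0)) := :- (x :* (t :- t)))
          refl x (fromℕ F 2)
      , solve 0 (con (+ 0) :* con (+ 0) :+ con (+ 1) :* con (+ 1) :+ con (+ 1) :* con (+ 0) := con (+ 1)) refl
    θ-powers (suc n) = E.trans (E.*-congˡ (θ-powers n))
      ( solve 3 (λ x a b → con (+ 0) :* (:- (x :* b)) :- x :* (con (+ 1) :* a) := :- (x :* a))
          refl x (D F (suc n) 2 x) (D F n 2 x)
      , solve 3 (λ x a b → con (+ 0) :* a :+ con (+ 1) :* (:- (x :* b)) :+ con (+ 1) :* a := a :- x :* b)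
          refl x (D F (suc n) 2 x) (D F n 2 x))

    s : Pair
    s = ιₑ 2 *ₑ θ +ₑ -ₑ 1ₑ

    discriminant : Carrier
    discriminant = 1# - ι 4 * x

    s-coordinates : s ≈ₑ (- 1# , ι 2)
    s-coordinates =
        solve 1 (λ x → con (+ 2) :* con (+ 0) :- x :* ((con (+ 0) :+ con (+ 0)) :* con (+ 1)) :+ :- con (+ 1)
                       := :- con (+ 1)) refl x
      , solve 0 (con (+ 2) :* con (+ 1) :+ (con (+ 0) :+ con (+ 0)) :* con (+ 0)
                   :+ (con (+ 0) :+ con (+ 0)) :* con (+ 1) :+ :- con (+ 0) := con (+ 2)) refl

    s² : s *ₑ s ≈ₑ emb discriminant
    s² = E.trans (E.*-cong s-coordinates s-coordinates)
      ( solve 1 (λ x → :- con (+ 1) :* :- con (+ 1) :- x :* (con (+ 2) :* con (+ 2))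
                       := con (+ 1) :- con (+ 4) :* x) refl x
      , solve 0 (:- con (+ 1) :* con (+ 2) :+ con (+ 2) :* :- con (+ 1) :+ con (+ 2) :* con (+ 2)
                   := con (+ 0)) refl)

    δ : Carrier
    δ = discriminant ^ m

    s^q : s ^ₑ q ≈ₑ s *ₑ emb δ
    s^q = ER.begin
      s ^ₑ q                   ER.≈⟨ ^ₑ-congʳ s q-odd ⟩
      s *ₑ s ^ₑ (m ℕ.+ m)      ER.≈⟨ E.*-congˡ (^ₑ-homo-* s m m) ⟩
      s *ₑ (s ^ₑ m *ₑ s ^ₑ m)  ER.≈⟨ E.*-congˡ (E.sym (^ₑ-distrib-* s s m)) ⟩
      s *ₑ (s *ₑ s) ^ₑ m       ER.≈⟨ E.*-congˡ (^ₑ-congˡ m s²) ⟩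
      s *ₑ emb discriminant ^ₑ m ER.≈⟨ E.*-congˡ (emb-^ discriminant m) ⟩
      s *ₑ emb δ               ER.∎

    frobenius-s : s ^ₑ q ≈ₑ ιₑ 2 *ₑ θ ^ₑ q +ₑ -ₑ 1ₑ
    frobenius-s = ER.begin
      (ιₑ 2 *ₑ θ +ₑ -ₑ 1ₑ) ^ₑ q              ER.≈⟨ frobenius-iterated-+ l _ _ ⟩
      (ιₑ 2 *ₑ θ) ^ₑ q +ₑ (-ₑ 1ₑ) ^ₑ q       ER.≈⟨ E.+-cong (^ₑ-distrib-* (ιₑ 2) θ q)
                                                            (frobenius-- l 1ₑ) ⟩
      ιₑ 2 ^ₑ q *ₑ θ ^ₑ q +ₑ -ₑ (1ₑ ^ₑ q)    ER.≈⟨ E.+-cong (E.*-congʳ (frobenius-fixes-ι l 2))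
                                                            (E.-‿cong (frobenius-fixes-ι l 1)) ⟩
      ιₑ 2 *ₑ θ ^ₑ q +ₑ -ₑ 1ₑ                ER.∎

    doubled-θ^[q+3] : ιₑ 2 *ₑ θ ^ₑ (q ℕ.+ 3) ≈ₑ (1ₑ +ₑ s *ₑ emb δ) *ₑ θ ^ₑ 3
    doubled-θ^[q+3] = ER.begin
      ιₑ 2 *ₑ θ ^ₑ (q ℕ.+ 3)                   ER.≈⟨ E.*-congˡ (^ₑ-homo-* θ q 3) ⟩
      ιₑ 2 *ₑ (θ ^ₑ q *ₑ θ ^ₑ 3)               ER.≈⟨ E.sym (E.*-assoc _ _ _) ⟩
      (ιₑ 2 *ₑ θ ^ₑ q) *ₑ θ ^ₑ 3               ER.≈⟨ E.*-congʳ doubled-θ^q ⟩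
      (1ₑ +ₑ s *ₑ emb δ) *ₑ θ ^ₑ 3             ER.∎
      where
      doubled-θ^q : ιₑ 2 *ₑ θ ^ₑ q ≈ₑ 1ₑ +ₑ s *ₑ emb δ
      doubled-θ^q = ER.begin
        ιₑ 2 *ₑ θ ^ₑ q                            ER.≈⟨ E.sym (E.+-identityʳ _) ⟩
        ιₑ 2 *ₑ θ ^ₑ q +ₑ 0ₑ                      ER.≈⟨ E.+-congˡ (E.sym (E.-‿inverseˡ 1ₑ)) ⟩
        ιₑ 2 *ₑ θ ^ₑ q +ₑ (-ₑ 1ₑ +ₑ 1ₑ)           ER.≈⟨ E.sym (E.+-assoc _ _ _) ⟩
        (ιₑ 2 *ₑ θ ^ₑ q +ₑ -ₑ 1ₑ) +ₑ 1ₑ           ER.≈⟨ E.+-congʳ (E.trans (E.sym frobenius-s) s^q) ⟩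
        s *ₑ emb δ +ₑ 1ₑ                          ER.≈⟨ E.+-comm _ _ ⟩
        1ₑ +ₑ s *ₑ emb δ                          ER.∎

    θ^[q+3] : θ ^ₑ (q ℕ.+ 3) ≈ₑ (- (x * D F (q ℕ.+ 2) 2 x) , D F (q ℕ.+ 3) 2 x)
    θ^[q+3] rewrite ℕP.+-suc q 2 = θ-powers (q ℕ.+ 2)

    closed-form : ι 2 * D F (q ℕ.+ 3) 2 x ≈ (1# - x) + δ * (1# - ι 3 * x)
    closed-form = begin
      ι 2 * D F (q ℕ.+ 3) 2 x
        ≈⟨ solve 2 (λ u v → con (+ 2) :* v
                     := (con (+ 1) :+ con (+ 1)) :* v :+ (con (+ 0) :+ con (+ 0)) :* u
                        :+ (con (+ 0) :+ con (+ 0)) :* v) refl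
             (- (x * D F (q ℕ.+ 2) 2 x)) (D F (q ℕ.+ 3) 2 x) ⟩
      proj₂ (ιₑ 2 *ₑ (- (x * D F (q ℕ.+ 2) 2 x) , D F (q ℕ.+ 3) 2 x))
        ≈⟨ proj₂ (E.*-congˡ (E.sym θ^[q+3])) ⟩
      proj₂ (ιₑ 2 *ₑ θ ^ₑ (q ℕ.+ 3))
        ≈⟨ proj₂ doubled-θ^[q+3] ⟩
      proj₂ ((1ₑ +ₑ s *ₑ emb δ) *ₑ θ ^ₑ 3)
        ≈⟨ proj₂ (E.*-cong (E.+-congˡ (E.*-congʳ s-coordinates)) (θ-powers 2)) ⟩
      proj₂ ((1ₑ +ₑ (- 1# , ι 2) *ₑ emb δ) *ₑ (- (x * D F 2 2 x) , D F 3 2 x))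
        ≈⟨ solve 3 (λ x δ t →
             let D₂ = con (+ 1) :- x :* (t :- t)
                 D₃ = D₂ :- x :* con (+ 1)
                 α  = :- con (+ 1) :* δ :- x :* (con (+ 2) :* con (+ 0))
                 β  = :- con (+ 1) :* con (+ 0) :+ con (+ 2) :* δ :+ con (+ 2) :* con (+ 0)
             in (con (+ 1) :+ α) :* D₃ :+ (con (+ 0) :+ β) :* (:- (x :* D₂)) :+ (con (+ 0) :+ β) :* D₃
                := (con (+ 1) :- x) :+ δ :* (con (+ 1) :- con (+ 3) :* x))
             refl x δ (fromℕ F 2) ⟩
      (1# - x) + δ * (1# - ι 3 * x)
        ∎

-- The exponent m only
-- enters through χ(a) = a ^ m, which is 0 at 0, 1 at nonzero squares c²
-- of elements c fixed by a ↦ a ^ q, and (-1)^m at -c².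
module Collisions (p e l m : ℕ) (pr : Prime p) (3<p : 3 < p) (F : FiniteField (p ℕ.^ e))
                  (q-odd : p ℕ.^ l ≡ suc (m ℕ.+ m)) (m≢0 : NonZero m) where
  import Data.Nat.Properties as ℕP
  open import Data.Nat.Divisibility using (∣⇒≤)
  open import Data.Nat.Primality using (prime?; prime⇒irreducible; ¬prime[1])
  open import Data.Integer using (+_)
  open import Data.Product using (∃₂; _×_; _,_; proj₁; proj₂)
  open import Data.Sum using (inj₁; inj₂)
  open import Relation.Nullary using (¬_)
  open import Relation.Nullary.Decidable using (from-yes)
  import Relation.Binary.PropositionalEquality as P

  open FiniteField F
  open IntegerSolver cring using (ι; solve; _:=_; _:+_; _:*_; _:-_; :-_; con)
  open FieldBasics F using (fromℕ≈ι; pow≈^; *-cancelˡ; *-nonzero)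
  open PrimeCharacteristic p e pr F using (char; ι≈0⇒∣)
  open Frobenius.Map cring pr char using (frobenius-fixes-ι)
  open DicksonClosedForm p e l m pr F q-odd using (closed-form)
  open OddPowers using (parity; ⌈half⌉; ⌊half⌋)
  open import Algebra.Properties.Semiring.Exp semiring using (_^_; ^-congˡ; ^-congʳ; ^-homo-*)
  open import Algebra.Properties.CommutativeSemiring.Exp commutativeSemiring using (^-distrib-*)
  open import Relation.Binary.Reasoning.Setoid setoid

  private
    q = p ℕ.^ l

  Collision : (Carrier → Carrier) → Set
  Collision f = ∃₂ λ a b → ¬ a ≈ b × f a ≈ f b

  collision⇒¬permutation : ∀ f → Collision f → ¬ IsPermutation F f
  collision⇒¬permutation f (a , b , a≉b , fa≈fb) (injective , _) = a≉b (injective fa≈fb)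

  ι2≉0 : ¬ ι 2 ≈ 0#
  ι2≉0 ι2≈0 = ℕP.<⇒≱ 3<p (ℕP.m≤n⇒m≤1+n (∣⇒≤ (ι≈0⇒∣ 2 ι2≈0)))

  ι3≉0 : ¬ ι 3 ≈ 0#
  ι3≉0 ι3≈0 = ℕP.<⇒≱ 3<p (∣⇒≤ (ι≈0⇒∣ 3 ι3≈0))

  ι13≉0 : p ≢ 13 → ¬ ι 13 ≈ 0#
  ι13≉0 p≢13 ι13≈0 with prime⇒irreducible (from-yes (prime? 13)) (ι≈0⇒∣ 13 ι13≈0)
  ... | inj₁ P.refl = ¬prime[1] pr
  ... | inj₂ p≡13   = p≢13 p≡13

  h : Carrier
  h = proj₁ (inverse (ι 2) ι2≉0)

  2h≈1 : ι 2 * h ≈ 1#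
  2h≈1 = proj₂ (inverse (ι 2) ι2≉0)

  h≉0 : ¬ h ≈ 0#
  h≉0 h≈0 = 0≉1 (trans (sym (zeroʳ (ι 2))) (trans (*-congˡ (sym h≈0)) 2h≈1))

  h²≉0 : ¬ h * h ≈ 0#
  h²≉0 = *-nonzero h h h≉0 h≉0

  -- identities that hold modulo the relation 2h = 1
  mod-2h : ∀ a b c → a ≈ b + (ι 2 * h - 1#) * c → a ≈ b
  mod-2h a b c a≈b+[2h-1]c = begin
    a                         ≈⟨ a≈b+[2h-1]c ⟩
    b + (ι 2 * h - 1#) * c    ≈⟨ +-congˡ (*-congʳ (trans (+-congʳ 2h≈1) (-‿inverseʳ 1#))) ⟩
    b + 0# * c                ≈⟨ +-congˡ (zeroˡ c) ⟩
    b + 0#                    ≈⟨ +-identityʳ b ⟩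
    b                         ∎

  Fixed : Carrier → Set
  Fixed a = a ^ q ≈ a

  fixed-h : Fixed h
  fixed-h = *-cancelˡ (ι 2) (h ^ q) h ι2≉0 (begin
    ι 2 * h ^ q       ≈⟨ *-congʳ (sym (frobenius-fixes-ι l 2)) ⟩
    ι 2 ^ q * h ^ q   ≈⟨ sym (^-distrib-* (ι 2) h q) ⟩
    (ι 2 * h) ^ q     ≈⟨ ^-congˡ q 2h≈1 ⟩
    ι 1 ^ q           ≈⟨ frobenius-fixes-ι l 1 ⟩
    1#                ≈⟨ sym 2h≈1 ⟩
    ι 2 * h           ∎)

  χ-zero : 0# ^ m ≈ 0#
  χ-zero = zero^ m m≢0
    where
    zero^ : ∀ n → NonZero n → 0# ^ n ≈ 0#
    zero^ (suc n) _ = zeroˡ _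

  -- c ^ (2m+1) = c gives (c²) ^ m = 1
  χ-square : ∀ c → Fixed c → ¬ c ≈ 0# → (c * c) ^ m ≈ 1#
  χ-square c c-fixed c≉0 = *-cancelˡ c _ _ c≉0 (begin
    c * (c * c) ^ m          ≈⟨ *-congˡ (^-distrib-* c c m) ⟩
    c * (c ^ m * c ^ m)      ≈⟨ *-congˡ (sym (^-homo-* c m m)) ⟩
    c ^ suc (m ℕ.+ m)        ≈⟨ ^-congʳ c (P.sym q-odd) ⟩
    c ^ q                    ≈⟨ c-fixed ⟩
    c                        ≈⟨ sym (*-identityʳ c) ⟩
    c * 1#                   ∎)

  neg^even : ∀ a j → (- a) ^ (j ℕ.+ j) ≈ a ^ (j ℕ.+ j)
  neg^even a j = begin
    (- a) ^ (j ℕ.+ j)          ≈⟨ ^-homo-* (- a) j j ⟩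
    (- a) ^ j * (- a) ^ j      ≈⟨ sym (^-distrib-* (- a) (- a) j) ⟩
    (- a * - a) ^ j            ≈⟨ ^-congˡ j (solve 1 (λ a → :- a :* :- a := a :* a) refl a) ⟩
    (a * a) ^ j                ≈⟨ ^-distrib-* a a j ⟩
    a ^ j * a ^ j              ≈⟨ sym (^-homo-* a j j) ⟩
    a ^ (j ℕ.+ j)              ∎

  χ-neg-square-even : ∀ j → m ≡ j ℕ.+ j → ∀ c → Fixed c → ¬ c ≈ 0# → (- (c * c)) ^ m ≈ 1#
  χ-neg-square-even j m≡2j c c-fixed c≉0 = begin
    (- (c * c)) ^ m            ≡⟨ P.cong ((- (c * c)) ^_) m≡2j ⟩
    (- (c * c)) ^ (j ℕ.+ j)    ≈⟨ neg^even (c * c) j ⟩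
    (c * c) ^ (j ℕ.+ j)        ≡⟨ P.cong ((c * c) ^_) (P.sym m≡2j) ⟩
    (c * c) ^ m                ≈⟨ χ-square c c-fixed c≉0 ⟩
    1#                         ∎

  χ-neg-square-odd : ∀ j → m ≡ suc (j ℕ.+ j) → ∀ c → Fixed c → ¬ c ≈ 0# → (- (c * c)) ^ m ≈ - 1#
  χ-neg-square-odd j m≡2j+1 c c-fixed c≉0 = begin
    (- (c * c)) ^ m                          ≡⟨ P.cong ((- (c * c)) ^_) m≡2j+1 ⟩
    - (c * c) * (- (c * c)) ^ (j ℕ.+ j)      ≈⟨ *-congˡ (neg^even (c * c) j) ⟩
    - (c * c) * (c * c) ^ (j ℕ.+ j)          ≈⟨ solve 2 (λ a b → :- a :* b := :- (a :* b)) refl (c * c) _ ⟩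
    - ((c * c) ^ suc (j ℕ.+ j))              ≡⟨ P.cong (λ k → - ((c * c) ^ k)) (P.sym m≡2j+1) ⟩
    - ((c * c) ^ m)                          ≈⟨ -‿cong (χ-square c c-fixed c≉0) ⟩
    - 1#                                     ∎

  distinct-if : ∀ a b d → ¬ d ≈ 0# → d ≈ b - a → ¬ a ≈ b
  distinct-if a b d d≉0 d≈b-a a≈b = d≉0 (begin
    d          ≈⟨ d≈b-a ⟩
    b - a      ≈⟨ +-congʳ (sym a≈b) ⟩
    a - a      ≈⟨ -‿inverseʳ a ⟩
    0#         ∎)

  module Dickson where

    Dq+3 : Carrier → Carrier
    Dq+3 x = D F (q ℕ.+ 3) 2 x

    doubled : ∀ x c → (1# - ι 4 * x) ^ m ≈ c → ι 2 * Dq+3 x ≈ (1# - x) + c * (1# - ι 3 * x)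
    doubled x c χ≈c = trans (closed-form x) (+-congˡ (*-congʳ χ≈c))

    collision-from : ∀ x y → ¬ x ≈ y → ι 2 * Dq+3 x ≈ ι 2 * Dq+3 y → Collision Dq+3
    collision-from x y x≉y 2Dx≈2Dy = x , y , x≉y , *-cancelˡ (ι 2) _ _ ι2≉0 2Dx≈2Dy

    -- m even: x₁ = 1/4 (where 1 - 4x = 0) and x₂ = 5/16 (where 1 - 4x = -1/4)
    collision-even : ∀ j → m ≡ j ℕ.+ j → Collision Dq+3
    collision-even j m≡2j = collision-from x₁ x₂ x₁≉x₂ (begin
      ι 2 * Dq+3 x₁                          ≈⟨ doubled x₁ 0# χ₁ ⟩
      (1# - x₁) + 0# * (1# - ι 3 * x₁)       ≈⟨ mod-2h _ _ _ (solve 1 (λ h →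
          (con (+ 1) :- h :* h) :+ con (+ 0) :* (con (+ 1) :- con (+ 3) :* (h :* h))
          := (con (+ 1) :- (h :* h :+ (h :* h) :* (h :* h)))
               :+ con (+ 1) :* (con (+ 1) :- con (+ 3) :* (h :* h :+ (h :* h) :* (h :* h)))
             :+ (con (+ 2) :* h :- con (+ 1)) :* (con (+ 1) :+ con (+ 2) :* h :+ h :* h :+ con (+ 2) :* (h :* (h :* h))))
          refl h) ⟩
      (1# - x₂) + 1# * (1# - ι 3 * x₂)       ≈⟨ sym (doubled x₂ 1# χ₂) ⟩
      ι 2 * Dq+3 x₂                          ∎)
      where
      x₁ x₂ : Carrier
      x₁ = h * h
      x₂ = h * h + (h * h) * (h * h)
      disc₁ : 1# - ι 4 * x₁ ≈ 0#
      disc₁ = mod-2h _ _ _ (solve 1 (λ h →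
        con (+ 1) :- con (+ 4) :* (h :* h)
        := con (+ 0) :+ (con (+ 2) :* h :- con (+ 1)) :* (:- con (+ 1) :- con (+ 2) :* h)) refl h)
      disc₂ : 1# - ι 4 * x₂ ≈ - (h * h)
      disc₂ = mod-2h _ _ _ (solve 1 (λ h →
        con (+ 1) :- con (+ 4) :* (h :* h :+ (h :* h) :* (h :* h))
        := :- (h :* h) :+ (con (+ 2) :* h :- con (+ 1))
                          :* (:- con (+ 1) :- con (+ 2) :* h :- h :* h :- con (+ 2) :* (h :* (h :* h)))) refl h)
      χ₁ : (1# - ι 4 * x₁) ^ m ≈ 0#
      χ₁ = trans (^-congˡ m disc₁) χ-zero
      χ₂ : (1# - ι 4 * x₂) ^ m ≈ 1#
      χ₂ = trans (^-congˡ m disc₂) (χ-neg-square-even j m≡2j h fixed-h h≉0)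
      x₁≉x₂ : ¬ x₁ ≈ x₂
      x₁≉x₂ = distinct-if x₁ x₂ ((h * h) * (h * h)) (*-nonzero _ _ h²≉0 h²≉0)
        (solve 1 (λ h → (h :* h) :* (h :* h) := (h :* h :+ (h :* h) :* (h :* h)) :- h :* h) refl h)

    -- m odd: x₃ = -3/4 (where 1 - 4x = 2²) and x₄ = 5/2 (where 1 - 4x = -3²)
    collision-odd : ∀ j → m ≡ suc (j ℕ.+ j) → p ≢ 13 → Collision Dq+3
    collision-odd j m≡2j+1 p≢13 = collision-from x₃ x₄ x₃≉x₄ (begin
      ι 2 * Dq+3 x₃                          ≈⟨ doubled x₃ 1# χ₃ ⟩
      (1# - x₃) + 1# * (1# - ι 3 * x₃)       ≈⟨ mod-2h _ _ _ (solve 1 (λ h →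
          (con (+ 1) :- :- (con (+ 3) :* (h :* h))) :+ con (+ 1) :* (con (+ 1) :- con (+ 3) :* :- (con (+ 3) :* (h :* h)))
          := (con (+ 1) :- con (+ 10) :* (h :* h)) :+ :- con (+ 1) :* (con (+ 1) :- con (+ 3) :* (con (+ 10) :* (h :* h)))
             :+ (con (+ 2) :* h :- con (+ 1)) :* (:- con (+ 2) :- con (+ 4) :* h))
          refl h) ⟩
      (1# - x₄) + - 1# * (1# - ι 3 * x₄)     ≈⟨ sym (doubled x₄ (- 1#) χ₄) ⟩
      ι 2 * Dq+3 x₄                          ∎)
      where
      x₃ x₄ : Carrier
      x₃ = - (ι 3 * (h * h))
      x₄ = ι 10 * (h * h)
      disc₃ : 1# - ι 4 * x₃ ≈ ι 2 * ι 2
      disc₃ = mod-2h _ _ _ (solve 1 (λ h →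
        con (+ 1) :- con (+ 4) :* :- (con (+ 3) :* (h :* h))
        := con (+ 2) :* con (+ 2) :+ (con (+ 2) :* h :- con (+ 1)) :* (con (+ 3) :+ con (+ 6) :* h)) refl h)
      disc₄ : 1# - ι 4 * x₄ ≈ - (ι 3 * ι 3)
      disc₄ = mod-2h _ _ _ (solve 1 (λ h →
        con (+ 1) :- con (+ 4) :* (con (+ 10) :* (h :* h))
        := :- (con (+ 3) :* con (+ 3)) :+ (con (+ 2) :* h :- con (+ 1)) :* (:- con (+ 10) :- con (+ 20) :* h)) refl h)
      χ₃ : (1# - ι 4 * x₃) ^ m ≈ 1#
      χ₃ = trans (^-congˡ m disc₃) (χ-square (ι 2) (frobenius-fixes-ι l 2) ι2≉0)
      χ₄ : (1# - ι 4 * x₄) ^ m ≈ - 1#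
      χ₄ = trans (^-congˡ m disc₄) (χ-neg-square-odd j m≡2j+1 (ι 3) (frobenius-fixes-ι l 3) ι3≉0)
      x₃≉x₄ : ¬ x₃ ≈ x₄
      x₃≉x₄ = distinct-if x₃ x₄ (ι 13 * (h * h)) (*-nonzero _ _ (ι13≉0 p≢13) h²≉0)
        (solve 1 (λ h → con (+ 13) :* (h :* h) := con (+ 10) :* (h :* h) :- :- (con (+ 3) :* (h :* h))) refl h)

    collision : p ≢ 13 → Collision Dq+3
    collision p≢13 with parity m
    ... | inj₁ (j , m≡2j)   = collision-even j m≡2j
    ... | inj₂ (j , m≡2j+1) = collision-odd j m≡2j+1 p≢13

  module Trinomial where

    g : Carrier → Carrier
    g z = fromℕ F 3 * pow F z ((q ℕ.+ 1) ℕ./ 2) + pow F z ((q ℕ.∸ 1) ℕ./ 2) + z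

    -- g(z) = 3zχ(z) + χ(z) + z, as (q + 1)/2 = m + 1 and (q - 1)/2 = m
    value : ∀ z c → z ^ m ≈ c → g z ≈ ι 3 * (z * c) + c + z
    value z c z^m≈c = +-cong (+-cong (*-cong (fromℕ≈ι 3) upper) lower) refl
      where
      upper : pow F z ((q ℕ.+ 1) ℕ./ 2) ≈ z * c
      upper = trans (reflexive (P.cong (pow F z) (P.trans (P.cong (λ k → (k ℕ.+ 1) ℕ./ 2) q-odd) (⌈half⌉ m))))
                    (trans (pow≈^ z (suc m)) (*-congˡ z^m≈c))
      lower : pow F z ((q ℕ.∸ 1) ℕ./ 2) ≈ c
      lower = trans (reflexive (P.cong (pow F z) (P.trans (P.cong (λ k → (k ℕ.∸ 1) ℕ./ 2) q-odd) (⌊half⌋ m))))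
                    (trans (pow≈^ z m) z^m≈c)

    -- m even: g(-1/4) = 0 = g(0)
    collision-even : ∀ j → m ≡ j ℕ.+ j → Collision g
    collision-even j m≡2j = x₅ , 0# , x₅≉0 , (begin
      g x₅                               ≈⟨ value x₅ 1# χ₅ ⟩
      ι 3 * (x₅ * 1#) + 1# + x₅          ≈⟨ mod-2h _ _ _ (solve 1 (λ h →
          con (+ 3) :* (:- (h :* h) :* con (+ 1)) :+ con (+ 1) :+ :- (h :* h)
          := con (+ 0) :+ (con (+ 2) :* h :- con (+ 1)) :* (:- con (+ 1) :- con (+ 2) :* h)) refl h) ⟩
      0#                                 ≈⟨ solve 0 (con (+ 0)
                                                  := con (+ 3) :* (con (+ 0) :* con (+ 0)) :+ con (+ 0) :+ con (+ 0))
                                                refl ⟩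
      ι 3 * (0# * 0#) + 0# + 0#          ≈⟨ sym (value 0# 0# χ-zero) ⟩
      g 0#                               ∎)
      where
      x₅ : Carrier
      x₅ = - (h * h)
      χ₅ : x₅ ^ m ≈ 1#
      χ₅ = χ-neg-square-even j m≡2j h fixed-h h≉0
      x₅≉0 : ¬ x₅ ≈ 0#
      x₅≉0 = distinct-if x₅ 0# (h * h) h²≉0
        (solve 1 (λ h → h :* h := con (+ 0) :- :- (h :* h)) refl h)

    -- m odd: g(4) = 17 = g(-9)
    collision-odd : ∀ j → m ≡ suc (j ℕ.+ j) → p ≢ 13 → Collision g
    collision-odd j m≡2j+1 p≢13 = x₆ , x₇ , x₆≉x₇ , (begin
      g x₆                               ≈⟨ value x₆ 1# χ₆ ⟩
      ι 3 * (x₆ * 1#) + 1# + x₆          ≈⟨ solve 0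
          (con (+ 3) :* (con (+ 2) :* con (+ 2) :* con (+ 1)) :+ con (+ 1) :+ con (+ 2) :* con (+ 2)
           := con (+ 3) :* (:- (con (+ 3) :* con (+ 3)) :* :- con (+ 1)) :+ :- con (+ 1) :+ :- (con (+ 3) :* con (+ 3)))
          refl ⟩
      ι 3 * (x₇ * - 1#) + - 1# + x₇      ≈⟨ sym (value x₇ (- 1#) χ₇) ⟩
      g x₇                               ∎)
      where
      x₆ x₇ : Carrier
      x₆ = ι 2 * ι 2
      x₇ = - (ι 3 * ι 3)
      χ₆ : x₆ ^ m ≈ 1#
      χ₆ = χ-square (ι 2) (frobenius-fixes-ι l 2) ι2≉0
      χ₇ : x₇ ^ m ≈ - 1#
      χ₇ = χ-neg-square-odd j m≡2j+1 (ι 3) (frobenius-fixes-ι l 3) ι3≉0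
      x₆≉x₇ : ¬ x₆ ≈ x₇
      x₆≉x₇ x₆≈x₇ = distinct-if x₇ x₆ (ι 13) (ι13≉0 p≢13)
        (solve 0 (con (+ 13) := con (+ 2) :* con (+ 2) :- :- (con (+ 3) :* con (+ 3))) refl) (sym x₆≈x₇)

    collision : p ≢ 13 → Collision g
    collision p≢13 with parity m
    ... | inj₁ (j , m≡2j)   = collision-even j m≡2j
    ... | inj₂ (j , m≡2j+1) = collision-odd j m≡2j+1 p≢13

open import Data.Nat using (ℕ; _+_; _*_; _∸_; _^_; _/_; _<_; _≤_; _%_)
open import Data.Nat.Primality using (Prime)
open import Data.Nat.Divisibility using (_∣_)
open import Data.Product using (_×_)
open import Relation.Nullary using (¬_)
open import Function.Bundles using (_⇔_)

import Data.Nat.Properties as ℕP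
import Data.Integer as ℤ
open import Data.Nat.Divisibility using (divides; _∣?_)
open import Data.Product using (∃; _,_; proj₁; proj₂)
open import Data.Empty using (⊥-elim)
open import Function using (_∘_)
open import Function.Bundles using (mk⇔)
open import Relation.Nullary.Decidable using (from-no)
open import Relation.Binary.PropositionalEquality using (refl)
open OddPowers using (odd-prime-power; half-nonzero)

-- -1/4 ≡ 3 ≡ 4² (mod 13), so the hypothesis that -1/4 is a non-residue
-- excludes p = 13
excludes-13 : ∀ {p} → ((c : ℕ) → p ∣ (4 * c + 1) → ¬ IsQuadraticResidue p c) → p ≢ 13
excludes-13 hyp refl = hyp 3 (divides 1 refl) (from-no (13 ∣? 3) , ℤ.+ 4 , divides 1 refl)

mainTheorem5 : (p e l : ℕ) → Prime p → 5 < p → 1 ≤ e → 1 ≤ l →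
    ((c : ℕ) → p ∣ (4 * c + 1) → ¬ IsQuadraticResidue p c) →
    (F : FiniteField (p ^ e)) →
    IsPermutation F (λ x → D F (p ^ l + 3) 2 x)
      ⇔ IsPermutation F (λ x → FiniteField._+_ F (FiniteField._+_ F (FiniteField._*_ F (fromℕ F 3) (pow F x ((p ^ l + 1) / 2))) (pow F x ((p ^ l ∸ 1) / 2))) x)
mainTheorem5 p e l pr 5<p _ 1≤l hyp F =
  mk⇔ (⊥-elim ∘ collision⇒¬permutation _ (Dickson.collision p≢13))
      (⊥-elim ∘ collision⇒¬permutation _ (Trinomial.collision p≢13))
  where
  3<p : 3 < p
  3<p = ℕP.≤-<-trans (ℕP.m≤m+n 3 2) 5<p
  p≢13 : p ≢ 13
  p≢13 = excludes-13 hyp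
  q-odd : ∃ λ m → p ^ l ≡ suc (m + m)
  q-odd = odd-prime-power pr (ℕP.<-trans (ℕP.n<1+n 2) 3<p) l
  open Collisions p e l (proj₁ q-odd) pr 3<p F (proj₂ q-odd) (half-nonzero pr 1≤l (proj₂ q-odd))
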